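{- Let $\Sigma=(\Lambda,\Lambda',[\cdot,\cdot])$ be an integral torus with a polarization $\xi$ of type $(a_1,\dots,a_g)$, and let $A=a_g$. Then there exist an integral torus $\Sigma^{\mathrm{pp}}=(\Lambda,\Lambda',[\cdot,\cdot]^{\mathrm{pp}})$ with a principal polarization $\zeta$ and a dilation $f:\Sigma^{\mathrm{pp}}\to\Sigma$ such that $f^*\xi=A\zeta$.
   Context: An integral torus is a triple $(\Lambda,\Lambda',[\cdot,\cdot])$ of free abelian groups of the same finite rank $g$ and a bilinear pairing $[\cdot,\cdot]:\Lambda\times\Lambda'\to\mathbb R$ such that $\lambda'\mapsto[\cdot,\lambda']$ embeds $\Lambda'$ as a full-rank lattice in $\operatorname{Hom}(\Lambda,\mathbb R)$. A homomorphism $f=(f^\#,f_\#):(\Lambda_1,\Lambda_1',[\cdot,\cdot]_1)\to(\Lambda_2,\Lambda_2',[\cdot,\cdot]_2)$ is a pair of homomorphisms $f^\#:\Lambda_2\to\Lambda_1$, $f_\#:\Lambda_1'\to\Lambda_2'$ with $[f^\#\lambda_2,\lambda_1']_1=[\lambda_2,f_\#\lambda_1']_2$; it is a dilation if $f^\#$ is injective with finite-index image and $f_\#$ is an isomorphism. A polarization is a homomorphism $\xi:\Lambda'\to\Lambda$ such that $(x,y)\mapsto[\xi(x),y]$ is a symmetric positive definite form on $\Lambda'\otimes\mathbb R$; its type is its list of invariant factors $a_1|a_2|\cdots|a_g$ (Smith normal form); it is principal if bijective. For a homomorphism $f:\Sigma_1\to\Sigma_2$ and polarization $\xi_2$ on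 $\Sigma_2$, the induced form is $f^*\xi_2=f^\#\circ\xi_2\circ f_\#$. -}

module Defs where

open import Level using (0ℓ)
open import Data.Nat as ℕ using (ℕ; zero; suc)
open import Data.Nat.Divisibility using (_∣_)
open import Data.Integer as ℤ using (ℤ; +_; -[1+_])
open import Data.Fin as Fin using (Fin)
open import Data.Vec using (Vec; []; _∷_; zipWith; map; lookup; tabulate; last)
open import Data.Product using (Σ; ∃; _×_; _,_)
open import Data.Bool using (if_then_else_)
open import Relation.Nullary using (¬_; does)
open import Relation.Binary.PropositionalEquality using (_≡_; _≢_)
open import Relation.Binary.Structures using (IsTotalOrder)
open import Algebra.Structures using (IsCommutativeRing)

-- The real numbers, axiomatised as a complete ordered field
-- (unique up to isomorphism, so quantifying over all such structures
-- is the same as working with ℝ).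

record Reals : Set₁ where
  infixl 6 _+_
  infix 8 -_
  infixl 7 _*_
  infix 4 _≤_ _<_
  field
    ℝ    : Set
    _+_  : ℝ → ℝ → ℝ
    _*_  : ℝ → ℝ → ℝ
    -_   : ℝ → ℝ
    0# 1# : ℝ
    _≤_  : ℝ → ℝ → Set
    isCommutativeRing : IsCommutativeRing _≡_ _+_ _*_ -_ 0# 1#
    isTotalOrder      : IsTotalOrder _≡_ _≤_
    0≢1      : 0# ≢ 1#
    inverse  : ∀ x → x ≢ 0# → ∃ λ y → x * y ≡ 1#
    +-mono-≤ : ∀ {x y} z → x ≤ y → x + z ≤ y + z
    *-nonneg : ∀ {x y} → 0# ≤ x → 0# ≤ y → 0# ≤ x * y
    sup : (P : ℝ → Set) → ∃ P → (∃ λ b → ∀ x → P x → x ≤ b) →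
          ∃ λ s → (∀ x → P x → x ≤ s) × (∀ b → (∀ x → P x → x ≤ b) → s ≤ b)

  _<_ : ℝ → ℝ → Set
  x < y = (x ≤ y) × (x ≢ y)

  fromℕ : ℕ → ℝ
  fromℕ zero    = 0#
  fromℕ (suc n) = 1# + fromℕ n

  fromℤ : ℤ → ℝ
  fromℤ (+ n)     = fromℕ n
  fromℤ -[1+ n ]  = - fromℕ (suc n)

  ∑ : ∀ {n} → (Fin n → ℝ) → ℝ
  ∑ {zero}  f = 0#
  ∑ {suc n} f = f Fin.zero + ∑ (λ i → f (Fin.suc i))

-- Free abelian groups of rank g are represented as ℤ^g = Vec ℤ g.

ℤ^ : ℕ → Set
ℤ^ g = Vec ℤ g

_+ᵥ_ : ∀ {g} → ℤ^ g → ℤ^ g → ℤ^ g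
_+ᵥ_ = zipWith ℤ._+_

_•_ : ∀ {g} → ℤ → ℤ^ g → ℤ^ g
k • v = map (k ℤ.*_) v

e : ∀ {g} → Fin g → ℤ^ g
e j = tabulate (λ i → if does (i Fin.≟ j) then + 1 else + 0)

record Hom (m n : ℕ) : Set where
  constructor hom
  field
    fn       : ℤ^ m → ℤ^ n
    additive : ∀ u v → fn (u +ᵥ v) ≡ fn u +ᵥ fn v
open Hom public

Injective : ∀ {m n} → Hom m n → Set
Injective f = ∀ u v → fn f u ≡ fn f v → u ≡ v

Surjective : ∀ {m n} → Hom m n → Set
Surjective f = ∀ w → ∃ λ u → fn f u ≡ w

Bijective : ∀ {m n} → Hom m n → Set
Bijective f = Injective f × Surjective f

FiniteIndexImage : ∀ {m n} → Hom m n → Set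
FiniteIndexImage {n = n} f =
  Σ ℕ λ k → Σ (Fin k → ℤ^ n) λ reps →
    ∀ w → ∃ λ i → ∃ λ u → w ≡ reps i +ᵥ fn f u

diag : ∀ {g} → Vec ℕ g → ℤ^ g → ℤ^ g
diag a v = zipWith (λ ai vi → + ai ℤ.* vi) a v

DivChain : ∀ {g} → Vec ℕ g → Set
DivChain []               = Data.Unit.⊤ where import Data.Unit
DivChain (x ∷ [])         = Data.Unit.⊤ where import Data.Unit
DivChain (x ∷ y ∷ xs)     = (x ∣ y) × DivChain (y ∷ xs)

module _ (R : Reals) where
  open Reals R

  -- a pairing Λ × Λ' → ℝ with Λ = Λ' = ℤ^g
  Pairing : ℕ → Set
  Pairing g = ℤ^ g → ℤ^ g → ℝ

  -- (Λ, Λ', [·,·]) is an integral torus: [·,·] is bilinear and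
  -- λ' ↦ [·,λ'] embeds Λ' as a full-rank lattice in Hom(Λ,ℝ), i.e. the
  -- images of a basis of Λ' are ℝ-linearly independent in Hom(Λ,ℝ) ≅ ℝ^g.
  record IsIntegralTorus {g} (P : Pairing g) : Set where
    field
      additiveˡ : ∀ u v w → P (u +ᵥ v) w ≡ P u w + P v w
      additiveʳ : ∀ u v w → P u (v +ᵥ w) ≡ P u v + P u w
      fullRank  : ∀ (c : Fin g → ℝ) →
                  (∀ (l : ℤ^ g) → ∑ (λ j → c j * P l (e j)) ≡ 0#) →
                  ∀ j → c j ≡ 0#

  -- the form (x,y) ↦ [ξ x, y] on Λ', and its ℝ-bilinear extension to Λ' ⊗ ℝ
  form : ∀ {g} → Pairing g → Hom g g → ℤ^ g → ℤ^ g → ℝ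
  form P ξ x y = P (fn ξ x) y

  formℝ : ∀ {g} → Pairing g → Hom g g → (Fin g → ℝ) → (Fin g → ℝ) → ℝ
  formℝ P ξ u v = ∑ (λ i → ∑ (λ j → u i * v j * form P ξ (e i) (e j)))

  record IsPolarization {g} (P : Pairing g) (ξ : Hom g g) : Set where
    field
      symmetric   : ∀ x y → form P ξ x y ≡ form P ξ y x
      posDefinite : ∀ (u : Fin g → ℝ) → ¬ (∀ i → u i ≡ 0#) →
                    0# < formℝ P ξ u u

  -- ξ has type (a₁,…,a_g): Smith normal form, i.e. in suitable bases of
  -- Λ' and Λ the map ξ is diag(a₁,…,a_g), with a₁ ∣ ⋯ ∣ a_g.
  HasType : ∀ {g} → Hom g g → Vec ℕ g → Set
  HasType {g} ξ a = DivChain a ×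
    Σ (Hom g g) λ U → Σ (Hom g g) λ V →
      Bijective U × Bijective V × (∀ x → fn ξ (fn V x) ≡ fn U (diag a x))

  -- f = (f^#, f_#) : (Λ,Λ',P₁) → (Λ,Λ',P₂) is a homomorphism
  IsTorusHom : ∀ {g} → Pairing g → Pairing g → Hom g g → Hom g g → Set
  IsTorusHom P₁ P₂ f♯ f₍♯₎ = ∀ l₂ l₁' → P₁ (fn f♯ l₂) l₁' ≡ P₂ l₂ (fn f₍♯₎ l₁')

  IsDilation : ∀ {g} → Pairing g → Pairing g → Hom g g → Hom g g → Set
  IsDilation P₁ P₂ f♯ f₍♯₎ =
    IsTorusHom P₁ P₂ f♯ f₍♯₎ × Injective f♯ × FiniteIndexImage f♯ × Bijective f₍♯₎

-- With A = a_g, every invariant factor a_i divides A, so the Smith form ξ ∘ V = U ∘ diag a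
-- yields ξ' = V ∘ diag(A/a_i) ∘ U⁻¹ with ξ' ∘ ξ = A = ξ ∘ ξ'. Taking f_# = id, f^# = ξ' and
-- [x, y]ᵖᵖ = A⁻¹ [ξ x, y], the identity of Λ' is a principal polarization for [·,·]ᵖᵖ, and
-- f^# is injective with image containing AΛ. That A ≠ 0 follows from positive
-- definiteness: a polarization has trivial kernel.
module Submission where

open import Defs
open import Data.Nat using (ℕ; zero; suc; NonZero; _^_)
open import Data.Nat.Divisibility using (_∣_; divides; ∣-refl; ∣-trans)
open import Data.Integer as ℤ using (ℤ; +_; -[1+_])
import Data.Integer.Properties as ℤᵖ
open import Data.Integer.DivMod using (_/ℕ_; n%ℕd<d; a≡a%ℕn+[a/ℕn]*n)
open import Data.Fin as Fin using (Fin)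
import Data.Fin.Properties as Finᵖ
open import Data.Vec using (Vec; []; _∷_; last; replicate; lookup; tabulate)
open import Data.Vec.Properties using (∷-injectiveˡ; ∷-injectiveʳ; ≡-dec; zipWith-identityˡ)
open import Data.Vec.Relation.Unary.All using (All; []; _∷_)
open import Data.Product using (Σ; ∃; _×_; _,_; proj₁; proj₂)
open import Data.Empty using (⊥-elim)
open import Data.Sum using (inj₁; inj₂)
open import Function using (_∘_)
open import Relation.Nullary using (¬_)
open import Relation.Nullary.Decidable using (decidable-stable)
open import Relation.Binary.PropositionalEquality
  using (_≡_; _≢_; refl; sym; trans; cong; cong₂; subst; subst₂; module ≡-Reasoning)
open import Relation.Binary.Structures using (IsTotalOrder)
open import Algebra.Bundles using (CommutativeRing)
import Algebra.Properties.Ring as RingProperties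

open ≡-Reasoning

zeros : ∀ g → ℤ^ g
zeros g = replicate g (+ 0)

zeros-+ᵥ : ∀ g → zeros g +ᵥ zeros g ≡ zeros g
zeros-+ᵥ g = zipWith-identityˡ ℤᵖ.+-identityˡ (zeros g)

+ᵥ-idem⇒zeros : ∀ {g} (v : ℤ^ g) → v +ᵥ v ≡ v → v ≡ zeros g
+ᵥ-idem⇒zeros []      _  = refl
+ᵥ-idem⇒zeros (x ∷ v) eq = cong₂ _∷_
  (RingProperties.x+x≈x⇒x≈0 ℤᵖ.+-*-ring x (∷-injectiveˡ eq))
  (+ᵥ-idem⇒zeros v (∷-injectiveʳ eq))

0•v≡zeros : ∀ {g} (v : ℤ^ g) → (+ 0) • v ≡ zeros g
0•v≡zeros []      = refl
0•v≡zeros (x ∷ v) = cong (+ 0 ∷_) (0•v≡zeros v)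

suc•v : ∀ {g} n (v : ℤ^ g) → (+ suc n) • v ≡ v +ᵥ ((+ n) • v)
suc•v n []      = refl
suc•v n (x ∷ v) = cong₂ _∷_ (ℤᵖ.suc-* (+ n) x) (suc•v n v)

-[1+n]•v+[1+n]•v≡zeros : ∀ {g} n (v : ℤ^ g) → (-[1+ n ] • v) +ᵥ ((+ suc n) • v) ≡ zeros g
-[1+n]•v+[1+n]•v≡zeros n []      = refl
-[1+n]•v+[1+n]•v≡zeros n (x ∷ v) = cong₂ _∷_
  (trans (sym (ℤᵖ.*-distribʳ-+ x -[1+ n ] (+ suc n))) (cong (ℤ._* x) (ℤᵖ.+-inverseˡ (+ suc n))))
  (-[1+n]•v+[1+n]•v≡zeros n v)

•-cancel : ∀ {g} m (u v : ℤ^ g) → (+ suc m) • u ≡ (+ suc m) • v → u ≡ v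
•-cancel m []      []      _  = refl
•-cancel m (x ∷ u) (y ∷ v) eq = cong₂ _∷_
  (ℤᵖ.*-cancelˡ-≡ (+ suc m) x y (∷-injectiveˡ eq)) (•-cancel m u v (∷-injectiveʳ eq))

lookup≡0⇒zeros : ∀ {g} (w : ℤ^ g) → (∀ i → lookup w i ≡ + 0) → w ≡ zeros g
lookup≡0⇒zeros []      _ = refl
lookup≡0⇒zeros (x ∷ w) h = cong₂ _∷_ (h Fin.zero) (lookup≡0⇒zeros w (λ i → h (Fin.suc i)))

x∷w≡x•e₀+0∷w : ∀ {g} (x : ℤ) (w : ℤ^ g) → x ∷ w ≡ (x • e {suc g} Fin.zero) +ᵥ (+ 0 ∷ w)
x∷w≡x•e₀+0∷w x w = cong₂ _∷_
  (sym (trans (ℤᵖ.+-identityʳ (x ℤ.* + 1)) (ℤᵖ.*-identityʳ x))) (sym (x•0+w≡w w))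
  where
  x•0+w≡w : ∀ {g} (w : ℤ^ g) → (x • tabulate (λ _ → + 0)) +ᵥ w ≡ w
  x•0+w≡w []      = refl
  x•0+w≡w (y ∷ w) = cong₂ _∷_
    (trans (cong (ℤ._+ y) (ℤᵖ.*-zeroʳ x)) (ℤᵖ.+-identityˡ y)) (x•0+w≡w w)

idₕ : ∀ {g} → Hom g g
idₕ = hom (λ x → x) (λ _ _ → refl)

idₕ-bijective : ∀ {g} → Bijective (idₕ {g})
idₕ-bijective = (λ _ _ eq → eq) , (λ w → w , refl)

_∘ₕ_ : ∀ {l m n} → Hom m n → Hom l m → Hom l n
f ∘ₕ h = hom (λ x → fn f (fn h x))
  (λ u v → trans (cong (fn f) (additive h u v)) (additive f (fn h u) (fn h v)))

diag-+ᵥ : ∀ {g} (q : Vec ℕ g) (u v : ℤ^ g) → diag q (u +ᵥ v) ≡ diag q u +ᵥ diag q v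
diag-+ᵥ []      []      []      = refl
diag-+ᵥ (a ∷ q) (x ∷ u) (y ∷ v) = cong₂ _∷_ (ℤᵖ.*-distribˡ-+ (+ a) x y) (diag-+ᵥ q u v)

diagₕ : ∀ {g} → Vec ℕ g → Hom g g
diagₕ q = hom (diag q) (diag-+ᵥ q)

fn-zeros : ∀ {m n} (f : Hom m n) → fn f (zeros m) ≡ zeros n
fn-zeros {m} f = +ᵥ-idem⇒zeros _
  (trans (sym (additive f (zeros m) (zeros m))) (cong (fn f) (zeros-+ᵥ m)))

fn-•ℕ : ∀ {m n} (f : Hom m n) k (v : ℤ^ m) → fn f ((+ k) • v) ≡ (+ k) • fn f v
fn-•ℕ f zero    v = trans (cong (fn f) (0•v≡zeros v)) (trans (fn-zeros f) (sym (0•v≡zeros _)))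
fn-•ℕ f (suc k) v = begin
  fn f ((+ suc k) • v)          ≡⟨ cong (fn f) (suc•v k v) ⟩
  fn f (v +ᵥ ((+ k) • v))       ≡⟨ additive f v _ ⟩
  fn f v +ᵥ fn f ((+ k) • v)    ≡⟨ cong (fn f v +ᵥ_) (fn-•ℕ f k v) ⟩
  fn f v +ᵥ ((+ k) • fn f v)    ≡⟨ sym (suc•v k _) ⟩
  (+ suc k) • fn f v            ∎

module Inverse {g} (U : Hom g g) (bij : Bijective U) where

  inv : ℤ^ g → ℤ^ g
  inv w = proj₁ (proj₂ bij w)

  fn∘inv : ∀ w → fn U (inv w) ≡ w
  fn∘inv w = proj₂ (proj₂ bij w)

  inv∘fn : ∀ v → inv (fn U v) ≡ v
  inv∘fn v = proj₁ bij _ _ (fn∘inv (fn U v))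

  invₕ : Hom g g
  invₕ = hom inv λ u v → proj₁ bij _ _ (begin
    fn U (inv (u +ᵥ v))              ≡⟨ fn∘inv (u +ᵥ v) ⟩
    u +ᵥ v                           ≡⟨ sym (cong₂ _+ᵥ_ (fn∘inv u) (fn∘inv v)) ⟩
    fn U (inv u) +ᵥ fn U (inv v)     ≡⟨ sym (additive U (inv u) (inv v)) ⟩
    fn U (inv u +ᵥ inv v)            ∎)

-- Smith normal form and the invariant factors

DivChain⇒∣last : ∀ {n} (a : Vec ℕ (suc n)) → DivChain a → All (_∣ last a) a
DivChain⇒∣last (x ∷ [])     _        = ∣-refl ∷ []
DivChain⇒∣last (x ∷ y ∷ ys) (x∣y , c) with DivChain⇒∣last (y ∷ ys) c
... | y∣last ∷ rest = ∣-trans x∣y y∣last ∷ y∣last ∷ rest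

complementaryFactors : ∀ {g} L (a : Vec ℕ g) → All (_∣ L) a →
  Σ (Vec ℕ g) λ q → (∀ x → diag q (diag a x) ≡ (+ L) • x) × (∀ x → diag a (diag q x) ≡ (+ L) • x)
complementaryFactors L []       []                  = [] , (λ { [] → refl }) , (λ { [] → refl })
complementaryFactors L (a₀ ∷ a) (divides q₀ L≡q₀a₀ ∷ ps) with complementaryFactors L a ps
... | q , qa , aq = q₀ ∷ q , (λ { (x ∷ xs) → cong₂ _∷_ (q₀[a₀x] x) (qa xs) })
                           , (λ { (x ∷ xs) → cong₂ _∷_ (a₀[q₀x] x) (aq xs) })
  where
  q₀[a₀x] : ∀ x → + q₀ ℤ.* (+ a₀ ℤ.* x) ≡ + L ℤ.* x
  q₀[a₀x] x = begin
    + q₀ ℤ.* (+ a₀ ℤ.* x)    ≡⟨ sym (ℤᵖ.*-assoc (+ q₀) (+ a₀) x) ⟩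
    (+ q₀ ℤ.* + a₀) ℤ.* x    ≡⟨ cong (ℤ._* x) (trans (sym (ℤᵖ.pos-* q₀ a₀)) (cong +_ (sym L≡q₀a₀))) ⟩
    + L ℤ.* x                ∎
  a₀[q₀x] : ∀ x → + a₀ ℤ.* (+ q₀ ℤ.* x) ≡ + L ℤ.* x
  a₀[q₀x] x = begin
    + a₀ ℤ.* (+ q₀ ℤ.* x)    ≡⟨ sym (ℤᵖ.*-assoc (+ a₀) (+ q₀) x) ⟩
    (+ a₀ ℤ.* + q₀) ℤ.* x    ≡⟨ cong (ℤ._* x) (ℤᵖ.*-comm (+ a₀) (+ q₀)) ⟩
    (+ q₀ ℤ.* + a₀) ℤ.* x    ≡⟨ cong (ℤ._* x) (trans (sym (ℤᵖ.pos-* q₀ a₀)) (cong +_ (sym L≡q₀a₀))) ⟩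
    + L ℤ.* x                ∎

quasiInverse : ∀ {g} (ξ U V : Hom g g) (a : Vec ℕ g) → Bijective U → Bijective V →
  (∀ x → fn ξ (fn V x) ≡ fn U (diag a x)) → ∀ L → All (_∣ L) a →
  Σ (Hom g g) λ ξ' → (∀ x → fn ξ' (fn ξ x) ≡ (+ L) • x) × (∀ y → fn ξ (fn ξ' y) ≡ (+ L) • y)
quasiInverse ξ U V a bijU bijV ξV L a∣L with complementaryFactors L a a∣L
... | q , qa , aq = V ∘ₕ (diagₕ q ∘ₕ U.invₕ) , ξ'∘ξ , ξ∘ξ'
  where
  module U = Inverse U bijU
  module V = Inverse V bijV
  ξ'∘ξ : ∀ x → fn V (diag q (U.inv (fn ξ x))) ≡ (+ L) • x
  ξ'∘ξ x = begin
    fn V (diag q (U.inv (fn ξ x)))                    ≡⟨ cong (λ t → fn V (diag q (U.inv (fn ξ t)))) (sym (V.fn∘inv x)) ⟩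
    fn V (diag q (U.inv (fn ξ (fn V (V.inv x)))))     ≡⟨ cong (λ t → fn V (diag q (U.inv t))) (ξV (V.inv x)) ⟩
    fn V (diag q (U.inv (fn U (diag a (V.inv x)))))   ≡⟨ cong (λ t → fn V (diag q t)) (U.inv∘fn _) ⟩
    fn V (diag q (diag a (V.inv x)))                  ≡⟨ cong (fn V) (qa (V.inv x)) ⟩
    fn V ((+ L) • V.inv x)                            ≡⟨ fn-•ℕ V L (V.inv x) ⟩
    (+ L) • fn V (V.inv x)                            ≡⟨ cong ((+ L) •_) (V.fn∘inv x) ⟩
    (+ L) • x                                         ∎
  ξ∘ξ' : ∀ y → fn ξ (fn V (diag q (U.inv y))) ≡ (+ L) • y
  ξ∘ξ' y = begin
    fn ξ (fn V (diag q (U.inv y)))   ≡⟨ ξV _ ⟩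
    fn U (diag a (diag q (U.inv y))) ≡⟨ cong (fn U) (aq (U.inv y)) ⟩
    fn U ((+ L) • U.inv y)           ≡⟨ fn-•ℕ U L (U.inv y) ⟩
    (+ L) • fn U (U.inv y)           ≡⟨ cong ((+ L) •_) (U.fn∘inv y) ⟩
    (+ L) • y                        ∎

e-last : ∀ n → ℤ^ (suc n)
e-last zero    = + 1 ∷ []
e-last (suc n) = + 0 ∷ e-last n

e-last≢zeros : ∀ n → e-last n ≢ zeros (suc n)
e-last≢zeros zero    ()
e-last≢zeros (suc n) eq = e-last≢zeros n (∷-injectiveʳ eq)

diag-e-last : ∀ {n} (a : Vec ℕ (suc n)) → last a ≡ 0 → diag a (e-last n) ≡ zeros (suc n)
diag-e-last (x ∷ [])     eq = cong (λ t → + t ℤ.* + 1 ∷ []) eq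
diag-e-last (x ∷ y ∷ ys) eq = cong₂ _∷_ (ℤᵖ.*-zeroʳ (+ x)) (diag-e-last (y ∷ ys) eq)

last≢0 : ∀ {n} (ξ U V : Hom (suc n) (suc n)) (a : Vec ℕ (suc n)) → Injective V →
  (∀ x → fn ξ (fn V x) ≡ fn U (diag a x)) →
  (∀ w → fn ξ w ≡ zeros (suc n) → w ≡ zeros (suc n)) → last a ≢ 0
last≢0 {n} ξ U V a injV ξV kerξ last≡0 = e-last≢zeros n (injV _ _ (begin
  fn V (e-last n)        ≡⟨ kerξ _ (trans (ξV _) (trans (cong (fn U) (diag-e-last a last≡0)) (fn-zeros U))) ⟩
  zeros (suc n)          ≡⟨ sym (fn-zeros V) ⟩
  fn V (zeros (suc n))   ∎))

-- Subgroups containing A ℤ^g have finite index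

residues : ∀ A g → Fin (A ^ g) → ℤ^ g
residues A zero    _ = []
residues A (suc g) i with Fin.remQuot {A} (A ^ g) i
... | r , j = + Fin.toℕ r ∷ residues A g j

residue-decomposition : ∀ A g .{{_ : NonZero A}} (w : ℤ^ g) →
  ∃ λ i → ∃ λ q → w ≡ residues A g i +ᵥ ((+ A) • q)
residue-decomposition A zero    []       = Fin.zero , [] , refl
residue-decomposition A (suc g) (x ∷ ws) with residue-decomposition A g ws
... | j , q , ws≡ = Fin.combine r j , x /ℕ A ∷ q ,
  subst (λ p → x ∷ ws ≡ (+ Fin.toℕ (proj₁ p) ∷ residues A g (proj₂ p)) +ᵥ ((+ A) • (x /ℕ A ∷ q)))
        (sym (Finᵖ.remQuot-combine r j)) (cong₂ _∷_ x≡r+Aq ws≡)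
  where
  r : Fin A
  r = Fin.fromℕ< (n%ℕd<d x A)
  x≡r+Aq : x ≡ + Fin.toℕ r ℤ.+ + A ℤ.* (x /ℕ A)
  x≡r+Aq = trans (a≡a%ℕn+[a/ℕn]*n x A)
    (cong₂ ℤ._+_ (cong +_ (sym (Finᵖ.toℕ-fromℕ< (n%ℕd<d x A)))) (ℤᵖ.*-comm (x /ℕ A) (+ A)))

finiteIndex-⊇-multiples : ∀ {g} (f : Hom g g) A .{{_ : NonZero A}} →
  (∀ q → ∃ λ u → fn f u ≡ (+ A) • q) → FiniteIndexImage f
finiteIndex-⊇-multiples {g} f A multiple = A ^ g , residues A g , λ w →
  let i , q , w≡ = residue-decomposition A g w
      u , fu≡Aq = multiple q
  in i , u , trans w≡ (cong (residues A g i +ᵥ_) (sym fu≡Aq))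

-- Real-valued forms

module _ (R : Reals) where
  open Reals R
  private
    commutativeRing : CommutativeRing _ _
    commutativeRing = record { isCommutativeRing = isCommutativeRing }
  open CommutativeRing commutativeRing
    using (+-comm; *-assoc; *-comm; distribˡ; distribʳ; zeroˡ; zeroʳ;
           +-identityˡ; -‿inverseʳ; *-identityˡ; ring)
  open RingProperties ring
    using (x+x≈x⇒x≈0; +-inverseˡ-unique; -0#≈0#; -‿distribˡ-*; -‿distribʳ-*; -‿involutive; -1*x≈-x)
  open IsTotalOrder isTotalOrder using (antisym; total) renaming (trans to ≤-trans; reflexive to ≤-reflexive)

  0≤x⇒-x≤0 : ∀ {x} → 0# ≤ x → - x ≤ 0#
  0≤x⇒-x≤0 {x} = subst₂ _≤_ (+-identityˡ (- x)) (-‿inverseʳ x) ∘ +-mono-≤ (- x)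

  x≤0⇒0≤-x : ∀ {x} → x ≤ 0# → 0# ≤ - x
  x≤0⇒0≤-x {x} = subst₂ _≤_ (-‿inverseʳ x) (+-identityˡ (- x)) ∘ +-mono-≤ (- x)

  0≤1 : 0# ≤ 1#
  0≤1 with total 0# 1#
  ... | inj₁ 0≤1 = 0≤1
  ... | inj₂ 1≤0 = subst (0# ≤_) (trans (-1*x≈-x (- 1#)) (-‿involutive 1#)) (*-nonneg 0≤-1 0≤-1)
    where
    0≤-1 = x≤0⇒0≤-x 1≤0

  ¬0≤-1 : ¬ (0# ≤ - 1#)
  ¬0≤-1 0≤-1 = 0≢1 (antisym 0≤1 (subst (_≤ 0#) (-‿involutive 1#) (0≤x⇒-x≤0 0≤-1)))

  0≤fromℕ : ∀ n → 0# ≤ fromℕ n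
  0≤fromℕ zero    = ≤-reflexive refl
  0≤fromℕ (suc n) = ≤-trans 0≤1
    (subst₂ _≤_ (+-identityˡ 1#) (+-comm (fromℕ n) 1#) (+-mono-≤ 1# (0≤fromℕ n)))

  fromℕ-suc≢0 : ∀ n → fromℕ (suc n) ≢ 0#
  fromℕ-suc≢0 n 1+n≡0 =
    ¬0≤-1 (subst (0# ≤_) (+-inverseˡ-unique (fromℕ n) 1# (trans (+-comm (fromℕ n) 1#) 1+n≡0)) (0≤fromℕ n))

  fromℤ≡0⇒≡0 : ∀ k → fromℤ k ≡ 0# → k ≡ + 0
  fromℤ≡0⇒≡0 (+ zero)  _  = refl
  fromℤ≡0⇒≡0 (+ suc n) eq = ⊥-elim (fromℕ-suc≢0 n eq)
  fromℤ≡0⇒≡0 -[1+ n ]  eq = ⊥-elim (fromℕ-suc≢0 n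
    (trans (sym (-‿involutive (fromℕ (suc n)))) (trans (cong -_ eq) -0#≈0#)))

  x*y≡0⇒y≡0 : ∀ {x y} → x ≢ 0# → x * y ≡ 0# → y ≡ 0#
  x*y≡0⇒y≡0 {x} {y} x≢0 xy≡0 with inverse x x≢0
  ... | x⁻¹ , xx⁻¹≡1 = begin
    y              ≡⟨ sym (*-identityˡ y) ⟩
    1# * y         ≡⟨ cong (_* y) (trans (sym xx⁻¹≡1) (*-comm x x⁻¹)) ⟩
    (x⁻¹ * x) * y  ≡⟨ *-assoc x⁻¹ x y ⟩
    x⁻¹ * (x * y)  ≡⟨ cong (x⁻¹ *_) xy≡0 ⟩
    x⁻¹ * 0#       ≡⟨ zeroʳ x⁻¹ ⟩
    0#             ∎

  *-pos : ∀ {x y} → 0# < x → 0# < y → 0# < x * y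
  *-pos (0≤x , 0≢x) (0≤y , 0≢y) =
    *-nonneg 0≤x 0≤y , λ 0≡xy → 0≢y (sym (x*y≡0⇒y≡0 (0≢x ∘ sym) (sym 0≡xy)))

  inverse-pos : ∀ {x y} → 0# ≤ x → x * y ≡ 1# → 0# < y
  inverse-pos {x} {y} 0≤x xy≡1 = 0≤y , λ 0≡y → 0≢1 (trans (sym (zeroʳ x)) (trans (cong (x *_) 0≡y) xy≡1))
    where
    0≤y : 0# ≤ y
    0≤y with total 0# y
    ... | inj₁ 0≤y = 0≤y
    ... | inj₂ y≤0 = ⊥-elim (¬0≤-1 (subst (0# ≤_)
      (trans (sym (-‿distribʳ-* x y)) (cong -_ xy≡1)) (*-nonneg 0≤x (x≤0⇒0≤-x y≤0))))

  ∑-cong : ∀ {n} {f h : Fin n → ℝ} → (∀ i → f i ≡ h i) → ∑ f ≡ ∑ h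
  ∑-cong {zero}  _  = refl
  ∑-cong {suc n} eq = cong₂ _+_ (eq Fin.zero) (∑-cong (eq ∘ Fin.suc))

  ∑-distribˡ : ∀ {n} c (f : Fin n → ℝ) → ∑ (λ i → c * f i) ≡ c * ∑ f
  ∑-distribˡ {zero}  c f = sym (zeroʳ c)
  ∑-distribˡ {suc n} c f = trans (cong (λ t → c * f Fin.zero + t) (∑-distribˡ c (f ∘ Fin.suc)))
                                 (sym (distribˡ c (f Fin.zero) (∑ (f ∘ Fin.suc))))

  Additive : ∀ {g} → (ℤ^ g → ℝ) → Set
  Additive φ = ∀ u v → φ (u +ᵥ v) ≡ φ u + φ v

  module _ {g} {φ : ℤ^ g → ℝ} (φ-additive : Additive φ) where

    additive-zeros : φ (zeros g) ≡ 0#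
    additive-zeros = x+x≈x⇒x≈0 _ (trans (sym (φ-additive _ _)) (cong φ (zeros-+ᵥ g)))

    additive-•ℕ : ∀ n v → φ ((+ n) • v) ≡ fromℕ n * φ v
    additive-•ℕ zero    v = trans (cong φ (0•v≡zeros v)) (trans additive-zeros (sym (zeroˡ (φ v))))
    additive-•ℕ (suc n) v = begin
      φ ((+ suc n) • v)            ≡⟨ cong φ (suc•v n v) ⟩
      φ (v +ᵥ ((+ n) • v))         ≡⟨ φ-additive _ _ ⟩
      φ v + φ ((+ n) • v)          ≡⟨ cong₂ _+_ (sym (*-identityˡ (φ v))) (additive-•ℕ n v) ⟩
      1# * φ v + fromℕ n * φ v     ≡⟨ sym (distribʳ (φ v) 1# (fromℕ n)) ⟩
      (1# + fromℕ n) * φ v         ∎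

    additive-• : ∀ k v → φ (k • v) ≡ fromℤ k * φ v
    additive-• (+ n)    v = additive-•ℕ n v
    additive-• -[1+ n ] v = begin
      φ (-[1+ n ] • v)             ≡⟨ +-inverseˡ-unique _ _ (trans (sym (φ-additive _ _))
                                        (trans (cong φ (-[1+n]•v+[1+n]•v≡zeros n v)) additive-zeros)) ⟩
      - φ ((+ suc n) • v)          ≡⟨ cong -_ (additive-•ℕ (suc n) v) ⟩
      - (fromℕ (suc n) * φ v)      ≡⟨ -‿distribˡ-* (fromℕ (suc n)) (φ v) ⟩
      - fromℕ (suc n) * φ v        ∎

  coords : ∀ {g} → ℤ^ g → Fin g → ℝ
  coords w j = fromℤ (lookup w j)

  coords≡0⇒zeros : ∀ {g} (w : ℤ^ g) → (∀ j → coords w j ≡ 0#) → w ≡ zeros g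
  coords≡0⇒zeros w h = lookup≡0⇒zeros w (λ j → fromℤ≡0⇒≡0 _ (h j))

  additive-expand : ∀ {g} {φ : ℤ^ g → ℝ} → Additive φ → ∀ w → φ w ≡ ∑ (λ j → coords w j * φ (e j))
  additive-expand {zero}  φ-additive []       = additive-zeros φ-additive
  additive-expand {suc g} {φ} φ-additive (x ∷ w) = begin
    φ (x ∷ w)                                   ≡⟨ cong φ (x∷w≡x•e₀+0∷w x w) ⟩
    φ ((x • e Fin.zero) +ᵥ (+ 0 ∷ w))           ≡⟨ φ-additive _ _ ⟩
    φ (x • e Fin.zero) + φ (+ 0 ∷ w)            ≡⟨ cong₂ _+_ (additive-• φ-additive x (e Fin.zero))
                                                    (additive-expand (λ u v → φ-additive (+ 0 ∷ u) (+ 0 ∷ v)) w) ⟩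
    fromℤ x * φ (e Fin.zero) + ∑ (λ j → coords w j * φ (+ 0 ∷ e j)) ∎

  formℝ-coords : ∀ {g} {P : Pairing R g} {ξ : Hom g g} → IsIntegralTorus R P →
    ∀ v w → formℝ R P ξ (coords v) (coords w) ≡ form R P ξ v w
  formℝ-coords {g} {P} {ξ} tor v w = begin
    ∑ (λ i → ∑ (λ j → coords v i * coords w j * F (e i) (e j)))
      ≡⟨ ∑-cong (λ i → ∑-cong (λ j → *-assoc (coords v i) (coords w j) (F (e i) (e j)))) ⟩
    ∑ (λ i → ∑ (λ j → coords v i * (coords w j * F (e i) (e j))))
      ≡⟨ ∑-cong (λ i → ∑-distribˡ {g} (coords v i) _) ⟩
    ∑ (λ i → coords v i * ∑ (λ j → coords w j * F (e i) (e j)))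
      ≡⟨ ∑-cong (λ i → cong (coords v i *_) (sym (additive-expand (additiveʳ (fn ξ (e i))) w))) ⟩
    ∑ (λ i → coords v i * F (e i) w)
      ≡⟨ sym (additive-expand (λ x y → trans (cong (λ t → P t w) (additive ξ x y)) (additiveˡ _ _ w)) v) ⟩
    F v w ∎
    where
    open IsIntegralTorus tor
    F = form R P ξ

  polarization-kernel : ∀ {g} {P : Pairing R g} {ξ : Hom g g} → IsIntegralTorus R P → IsPolarization R P ξ →
    ∀ w → fn ξ w ≡ zeros g → w ≡ zeros g
  -- Positive definiteness only refutes w ≢ 0; decidability of equality on ℤ^g recovers w ≡ 0.
  polarization-kernel {g} {P} {ξ} tor pol w ξw≡0 = decidable-stable (≡-dec ℤ._≟_ w (zeros g)) λ w≢0 →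
    proj₂ (IsPolarization.posDefinite pol (coords w) (w≢0 ∘ coords≡0⇒zeros w)) (sym (begin
      formℝ R P ξ (coords w) (coords w)   ≡⟨ formℝ-coords {ξ = ξ} tor w w ⟩
      P (fn ξ w) w                        ≡⟨ cong (λ t → P t w) ξw≡0 ⟩
      P (zeros g) w                       ≡⟨ additive-zeros (λ x y → IsIntegralTorus.additiveˡ tor x y w) ⟩
      0#                                  ∎))

  formℝ-scale : ∀ {g} {P P' : Pairing R g} {ξ ξ' : Hom g g} c →
    (∀ x y → form R P' ξ' x y ≡ c * form R P ξ x y) →
    ∀ u v → formℝ R P' ξ' u v ≡ c * formℝ R P ξ u v
  formℝ-scale {g} {P} {P'} {ξ} {ξ'} c scaled u v = begin
    ∑ (λ i → ∑ (λ j → u i * v j * form R P' ξ' (e i) (e j)))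
      ≡⟨ ∑-cong (λ i → ∑-cong (λ j → cong (u i * v j *_) (scaled (e i) (e j)))) ⟩
    ∑ (λ i → ∑ (λ j → u i * v j * (c * form R P ξ (e i) (e j))))
      ≡⟨ ∑-cong (λ i → ∑-cong (λ j → x[cy]≡c[xy] (u i * v j) _)) ⟩
    ∑ (λ i → ∑ (λ j → c * (u i * v j * form R P ξ (e i) (e j))))
      ≡⟨ ∑-cong (λ i → ∑-distribˡ c (λ j → u i * v j * form R P ξ (e i) (e j))) ⟩
    ∑ (λ i → c * ∑ (λ j → u i * v j * form R P ξ (e i) (e j)))
      ≡⟨ ∑-distribˡ {g} c _ ⟩
    c * formℝ R P ξ u v ∎
    where
    x[cy]≡c[xy] : ∀ x y → x * (c * y) ≡ c * (x * y)
    x[cy]≡c[xy] x y = trans (sym (*-assoc x c y)) (trans (cong (_* y) (*-comm x c)) (*-assoc c x y))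

  module PrincipalDilation {g} (P : Pairing R g) (ξ : Hom g g)
    (tor : IsIntegralTorus R P) (pol : IsPolarization R P ξ)
    (m : ℕ) (ξ' : Hom g g)
    (ξ'∘ξ : ∀ x → fn ξ' (fn ξ x) ≡ (+ suc m) • x)
    (ξ∘ξ' : ∀ y → fn ξ (fn ξ' y) ≡ (+ suc m) • y) where

    open IsIntegralTorus tor

    A⁻¹ : ℝ
    A⁻¹ = proj₁ (inverse (fromℕ (suc m)) (fromℕ-suc≢0 m))

    A*A⁻¹≡1 : fromℕ (suc m) * A⁻¹ ≡ 1#
    A*A⁻¹≡1 = proj₂ (inverse (fromℕ (suc m)) (fromℕ-suc≢0 m))

    Ppp : Pairing R g
    Ppp x y = A⁻¹ * P (fn ξ x) y

    isTorusHom : IsTorusHom R Ppp P ξ' idₕ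
    isTorusHom l y = begin
      A⁻¹ * P (fn ξ (fn ξ' l)) y           ≡⟨ cong (λ t → A⁻¹ * P t y) (ξ∘ξ' l) ⟩
      A⁻¹ * P ((+ suc m) • l) y            ≡⟨ cong (A⁻¹ *_) (additive-•ℕ (λ u v → additiveˡ u v y) (suc m) l) ⟩
      A⁻¹ * (fromℕ (suc m) * P l y)        ≡⟨ sym (*-assoc A⁻¹ (fromℕ (suc m)) (P l y)) ⟩
      (A⁻¹ * fromℕ (suc m)) * P l y        ≡⟨ cong (_* P l y) (trans (*-comm A⁻¹ (fromℕ (suc m))) A*A⁻¹≡1) ⟩
      1# * P l y                           ≡⟨ *-identityˡ (P l y) ⟩
      P l y                                ∎

    isIntegralTorus : IsIntegralTorus R Ppp
    isIntegralTorus = record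
      { additiveˡ = λ u v w → trans (cong (λ t → A⁻¹ * P t w) (additive ξ u v))
                                (trans (cong (A⁻¹ *_) (additiveˡ _ _ w)) (distribˡ A⁻¹ _ _))
      ; additiveʳ = λ u v w → trans (cong (A⁻¹ *_) (additiveʳ _ v w)) (distribˡ A⁻¹ _ _)
      ; fullRank  = λ c vanish → fullRank c (λ l →
          trans (∑-cong (λ j → cong (c j *_) (sym (isTorusHom l (e j))))) (vanish (fn ξ' l)))
      }

    isPolarization : IsPolarization R Ppp idₕ
    isPolarization = record
      { symmetric   = λ x y → cong (A⁻¹ *_) (IsPolarization.symmetric pol x y)
      ; posDefinite = λ u u≢0 → subst (0# <_) (sym (formℝ-scale {P = P} {Ppp} {ξ} {idₕ} A⁻¹ (λ _ _ → refl) u u))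
          (*-pos (inverse-pos (0≤fromℕ (suc m)) A*A⁻¹≡1) (IsPolarization.posDefinite pol u u≢0))
      }

    isDilation : IsDilation R Ppp P ξ' idₕ
    isDilation = isTorusHom , injective , finiteIndex-⊇-multiples ξ' (suc m) (λ q → fn ξ q , ξ'∘ξ q) , idₕ-bijective
      where
      injective : Injective ξ'
      injective l l' eq = •-cancel m l l' (trans (sym (ξ∘ξ' l)) (trans (cong (fn ξ) eq) (ξ∘ξ' l')))

lemma4p10 : (R : Reals) (n : ℕ) (P : Pairing R (suc n)) (ξ : Hom (suc n) (suc n))
    (a : Vec ℕ (suc n)) →
    IsIntegralTorus R P → IsPolarization R P ξ → HasType R ξ a →
    Σ (Pairing R (suc n)) λ Ppp → Σ (Hom (suc n) (suc n)) λ ζ →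
      Σ (Hom (suc n) (suc n)) λ f♯ → Σ (Hom (suc n) (suc n)) λ f₍♯₎ →
        IsIntegralTorus R Ppp × IsPolarization R Ppp ζ × Bijective ζ ×
        IsDilation R Ppp P f♯ f₍♯₎ ×
        (∀ x → fn f♯ (fn ξ (fn f₍♯₎ x)) ≡ (+ last a) • fn ζ x)
lemma4p10 R n P ξ a tor pol (chain , U , V , bijU , bijV , ξV) with last a in last≡A
... | zero  = ⊥-elim (last≢0 ξ U V a (proj₁ bijV) ξV (polarization-kernel R tor pol) last≡A)
... | suc m with quasiInverse ξ U V a bijU bijV ξV (suc m)
                   (subst (λ A → All (_∣ A) a) last≡A (DivChain⇒∣last a chain))
... | ξ' , ξ'∘ξ , ξ∘ξ' =
  Ppp , idₕ , ξ' , idₕ , isIntegralTorus , isPolarization , idₕ-bijective , isDilation , ξ'∘ξ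
  where open PrincipalDilation R P ξ tor pol m ξ' ξ'∘ξ ξ∘ξ'
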